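{- Let $n\ge k\ge t-1\ge1$ and let $\mathcal{F}\subseteq\binom{[n]}{k}\cup\binom{[n]}{k-1}\cup\dots\cup\binom{[n]}{k-t+1}$ be s-extremal. Then $\mathcal{F}$ has Vapnik–Chervonenkis dimension at most $t-1$.
   Context: $[n]=\{1,\dots,n\}$ and $\binom{[n]}{j}$ is the family of $j$-element subsets of $[n]$. A family $\mathcal{F}\subseteq 2^{[n]}$ shatters $S\subseteq[n]$ if $\{F\cap S: F\in\mathcal{F}\}=2^S$; $Sh(\mathcal{F})$ is the family of all sets shattered by $\mathcal{F}$; $\mathcal{F}$ is s-extremal if $|Sh(\mathcal{F})|=|\mathcal{F}|$. The Vapnik–Chervonenkis dimension of $\mathcal{F}$ is the maximum size of a set shattered by $\mathcal{F}$. -}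

module Defs where

open import Data.Nat using (ℕ; _≤_; _∸_)
open import Data.Fin.Subset using (Subset; _⊆_; _∩_; ∣_∣)
open import Data.List using (List; length)
open import Data.List.Membership.Propositional using (_∈_)
open import Data.List.Relation.Unary.Unique.Propositional using (Unique)
open import Data.Product using (Σ; ∃; _×_)
open import Function.Bundles using (_⇔_)
open import Relation.Binary.PropositionalEquality using (_≡_)

record Family (n : ℕ) : Set where
  constructor family
  field
    members  : List (Subset n)
    distinct : Unique members
open Family public

card : ∀ {n} → Family n → ℕ
card 𝓕 = length (members 𝓕)

-- 𝓕 shatters S : {F ∩ S : F ∈ 𝓕} = 2^S, i.e. every T ⊆ S is F ∩ S for some F ∈ 𝓕
-- (the inclusion {F ∩ S} ⊆ 2^S is automatic).
Shatters : ∀ {n} → Family n → Subset n → Set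
Shatters 𝓕 S = ∀ T → T ⊆ S → ∃ λ F → F ∈ members 𝓕 × F ∩ S ≡ T

IsSh : ∀ {n} → Family n → Family n → Set
IsSh 𝓕 L = ∀ S → (S ∈ members L) ⇔ Shatters 𝓕 S

SExtremal : ∀ {n} → Family n → Set
SExtremal 𝓕 = ∃ λ L → IsSh 𝓕 L × card L ≡ card 𝓕

VCdimAtMost : ∀ {n} → Family n → ℕ → Set
VCdimAtMost 𝓕 d = ∀ S → Shatters 𝓕 S → ∣ S ∣ ≤ d

InLevels : ∀ {n} → Family n → ℕ → ℕ → Set
InLevels 𝓕 k t = ∀ F → F ∈ members 𝓕 → (k ∸ (t ∸ 1) ≤ ∣ F ∣) × (∣ F ∣ ≤ k)

module Submission where

-- The key fact is that an s-extremal family contains, for every shattered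
-- set S, two members A and B with |B| = |A| + |S| (namely A and A ∪ S).  When
-- all members have size between k - (t-1) and k, this forces |S| ≤ t - 1.

open import Data.Bool using (true; false; _∧_)
import Data.Bool as Bool
open import Data.Bool.Properties using (∧-zeroʳ; ∧-identityʳ)
open import Data.Fin using (Fin; zero; suc)
open import Data.Fin.Subset using (Subset; _⊆_; _∩_; ∣_∣; outside; inside)
open import Data.Fin.Subset.Properties
  using (_⊆?_; ⊆-refl; anySubset?; drop-∷-⊆; out⊆; in⊆in)
open import Data.List using (List; []; _∷_; length)
open import Data.List.Membership.Propositional using (_∈_)
import Data.List.Relation.Unary.All as All
open import Data.List.Relation.Unary.AllPairs using ([]; _∷_)
open import Data.List.Relation.Unary.Unique.Propositional using (Unique)
open import Data.List.Relation.Unary.Any using (here; there; any?)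
open import Data.Nat using (ℕ; zero; suc; _+_; _∸_; _≤_; _<_; z≤n; s≤s)
open import Data.Nat.Properties
  using ( ≤-refl; ≤-reflexive; ≤-antisym; ≤-trans; <⇒≱; +-identityʳ; +-suc; suc-injective
        ; +-mono-≤; +-mono-<-≤; +-mono-≤-<; +-cancelˡ-≤; ∸-mono; m+n∸m≡n; m∸[m∸n]≡n
        ; +-commutativeSemigroup; module ≤-Reasoning)
open import Algebra.Properties.CommutativeSemigroup +-commutativeSemigroup
  using (interchange)
open import Data.Product using (∃; ∃₂; _×_; _,_; proj₁; proj₂)
open import Data.Sum using (_⊎_; inj₁; inj₂)
open import Data.Vec using ([]; _∷_; lookup; _[_]≔_; here)
open import Data.Vec.Properties
  using (≡-dec; lookup-zipWith; lookup∘update; []≔-idempotent; []≔-lookup)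
open import Function.Bundles using (Equivalence)
open import Relation.Nullary using (¬_; Dec; yes; no; contradiction)
open import Relation.Nullary.Decidable using (_×-dec_; _⊎-dec_; _→-dec_; ¬?; decidable-stable)
open import Relation.Binary.PropositionalEquality
  using (_≡_; refl; sym; trans; cong; cong₂; subst; subst₂; module ≡-Reasoning)

open import Defs

Pred? : ∀ {n} → (Subset n → Set) → Set
Pred? P = ∀ x → Dec (P x)

indicator : ∀ {A : Set} → Dec A → ℕ
indicator (yes _) = 1
indicator (no _)  = 0

count : ∀ {n} {P : Subset n → Set} → Pred? P → ℕ
count {zero}  P? = indicator (P? [])
count {suc n} P? = count (λ x → P? (false ∷ x)) + count (λ x → P? (true ∷ x))

count-mono : ∀ {n} {P Q : Subset n → Set} (P? : Pred? P) (Q? : Pred? Q) →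
  (∀ x → P x → Q x) → count P? ≤ count Q?
count-mono {n = zero} P? Q? P⊆Q with P? [] | Q? []
... | yes _ | yes _ = ≤-refl
... | yes p | no ¬q = contradiction (P⊆Q [] p) ¬q
... | no _  | _     = z≤n
count-mono {n = suc n} P? Q? P⊆Q =
  +-mono-≤ (count-mono _ _ (λ x → P⊆Q (false ∷ x))) (count-mono _ _ (λ x → P⊆Q (true ∷ x)))

count-cong : ∀ {n} {P Q : Subset n → Set} (P? : Pred? P) (Q? : Pred? Q) →
  (∀ x → P x → Q x) → (∀ x → Q x → P x) → count P? ≡ count Q?
count-cong P? Q? P⊆Q Q⊆P = ≤-antisym (count-mono P? Q? P⊆Q) (count-mono Q? P? Q⊆P)

count-empty : ∀ {n} {P : Subset n → Set} (P? : Pred? P) → (∀ x → ¬ P x) → count P? ≡ 0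
count-empty {zero} P? none with P? []
... | yes p = contradiction p (none [])
... | no _  = refl
count-empty {suc n} P? none =
  cong₂ _+_ (count-empty _ (λ x → none (false ∷ x))) (count-empty _ (λ x → none (true ∷ x)))

count-strict : ∀ {n} {P Q : Subset n → Set} (P? : Pred? P) (Q? : Pred? Q) →
  (∀ x → P x → Q x) → ∀ x → Q x → ¬ P x → count P? < count Q?
count-strict P? Q? P⊆Q [] q ¬p with P? [] | Q? []
... | yes p | _     = contradiction p ¬p
... | no _  | yes _ = s≤s z≤n
... | no _  | no ¬q = contradiction q ¬q
count-strict P? Q? P⊆Q (false ∷ x) q ¬p =
  +-mono-<-≤ (count-strict _ _ (λ y → P⊆Q (false ∷ y)) x q ¬p)
             (count-mono _ _ (λ y → P⊆Q (true ∷ y)))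
count-strict P? Q? P⊆Q (true ∷ x) q ¬p =
  +-mono-≤-< (count-mono _ _ (λ y → P⊆Q (false ∷ y)))
             (count-strict _ _ (λ y → P⊆Q (true ∷ y)) x q ¬p)

count-reflect : ∀ {n} {P Q : Subset n → Set} (P? : Pred? P) (Q? : Pred? Q) →
  (∀ x → P x → Q x) → count Q? ≤ count P? → ∀ x → Q x → P x
count-reflect P? Q? P⊆Q Q≤P x q with P? x
... | yes p = p
... | no ¬p = contradiction Q≤P (<⇒≱ (count-strict P? Q? P⊆Q x q ¬p))

count-∪∩ : ∀ {n} {P Q : Subset n → Set} (P? : Pred? P) (Q? : Pred? Q) →
  count P? + count Q? ≡ count (λ x → P? x ⊎-dec Q? x) + count (λ x → P? x ×-dec Q? x)
count-∪∩ {zero} P? Q? with P? [] | Q? []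
... | yes _ | yes _ = refl
... | yes _ | no _  = refl
... | no _  | yes _ = refl
... | no _  | no _  = refl
count-∪∩ {suc n} P? Q? = begin
  (p₀ + p₁) + (q₀ + q₁)  ≡⟨ interchange p₀ p₁ q₀ q₁ ⟩
  (p₀ + q₀) + (p₁ + q₁)
    ≡⟨ cong₂ _+_ (count-∪∩ (λ x → P? (false ∷ x)) (λ x → Q? (false ∷ x)))
                 (count-∪∩ (λ x → P? (true ∷ x)) (λ x → Q? (true ∷ x))) ⟩
  (u₀ + i₀) + (u₁ + i₁)  ≡⟨ interchange u₀ i₀ u₁ i₁ ⟩
  (u₀ + u₁) + (i₀ + i₁)  ∎
  where
  open ≡-Reasoning
  p₀ p₁ q₀ q₁ u₀ u₁ i₀ i₁ : ℕ
  p₀ = count (λ x → P? (false ∷ x))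
  p₁ = count (λ x → P? (true ∷ x))
  q₀ = count (λ x → Q? (false ∷ x))
  q₁ = count (λ x → Q? (true ∷ x))
  u₀ = count (λ x → P? (false ∷ x) ⊎-dec Q? (false ∷ x))
  u₁ = count (λ x → P? (true ∷ x) ⊎-dec Q? (true ∷ x))
  i₀ = count (λ x → P? (false ∷ x) ×-dec Q? (false ∷ x))
  i₁ = count (λ x → P? (true ∷ x) ×-dec Q? (true ∷ x))

count-disjoint : ∀ {n} {P Q : Subset n → Set} (P? : Pred? P) (Q? : Pred? Q) →
  (∀ x → P x → ¬ Q x) → count (λ x → P? x ⊎-dec Q? x) ≡ count P? + count Q?
count-disjoint P? Q? disjoint = begin
  union          ≡⟨ sym (+-identityʳ union) ⟩
  union + 0      ≡⟨ cong (union +_) (sym (count-empty (λ x → P? x ×-dec Q? x)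
                                            (λ x (p , q) → disjoint x p q))) ⟩
  union + count (λ x → P? x ×-dec Q? x)  ≡⟨ sym (count-∪∩ P? Q?) ⟩
  count P? + count Q?  ∎
  where
  open ≡-Reasoning
  union : ℕ
  union = count (λ x → P? x ⊎-dec Q? x)

infix 4 _≟_ _∈?_

_≟_ : ∀ {n} (x y : Subset n) → Dec (x ≡ y)
_≟_ = ≡-dec Bool._≟_

_∈?_ : ∀ {n} (x : Subset n) (xs : List (Subset n)) → Dec (x ∈ xs)
x ∈? xs = any? (x ≟_) xs

count-singleton : ∀ {n} (a : Subset n) → count (_≟ a) ≡ 1
count-singleton [] = refl
count-singleton (false ∷ a) = begin
  count (λ x → (false ∷ x) ≟ (false ∷ a)) + count (λ x → (true ∷ x) ≟ (false ∷ a))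
    ≡⟨ cong₂ _+_ (count-cong (λ x → (false ∷ x) ≟ (false ∷ a)) (_≟ a)
                             (λ { x refl → refl }) (λ { x refl → refl }))
                 (count-empty (λ x → (true ∷ x) ≟ (false ∷ a)) (λ x ())) ⟩
  count (_≟ a) + 0
    ≡⟨ +-identityʳ _ ⟩
  count (_≟ a)
    ≡⟨ count-singleton a ⟩
  1 ∎
  where open ≡-Reasoning
count-singleton (true ∷ a) =
  trans (cong₂ _+_ (count-empty (λ x → (false ∷ x) ≟ (true ∷ a)) (λ x ()))
                   (count-cong (λ x → (true ∷ x) ≟ (true ∷ a)) (_≟ a)
                               (λ { x refl → refl }) (λ { x refl → refl })))
        (count-singleton a)

count-∈ : ∀ {n} (xs : List (Subset n)) → Unique xs → count (_∈? xs) ≡ length xs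
count-∈ {n} [] [] = count-empty {n} (_∈? []) (λ x ())
count-∈ (a ∷ xs) (a∉xs ∷ unique) = begin
  count (_∈? (a ∷ xs))
    ≡⟨ count-cong (_∈? (a ∷ xs)) (λ x → (x ≟ a) ⊎-dec (x ∈? xs))
         (λ { x (here x≡a) → inj₁ x≡a ; x (there x∈xs) → inj₂ x∈xs })
         (λ { x (inj₁ x≡a) → here x≡a ; x (inj₂ x∈xs) → there x∈xs }) ⟩
  count (λ x → (x ≟ a) ⊎-dec (x ∈? xs))
    ≡⟨ count-disjoint (_≟ a) (_∈? xs) (λ { x refl a∈xs → All.lookup a∉xs a∈xs refl }) ⟩
  count (_≟ a) + count (_∈? xs)
    ≡⟨ cong₂ _+_ (count-singleton a) (count-∈ xs unique) ⟩
  suc (length xs) ∎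
  where open ≡-Reasoning

_shatters_ : ∀ {n} → (Subset n → Set) → Subset n → Set
g shatters S = ∀ T → T ⊆ S → ∃ λ F → g F × F ∩ S ≡ T

allSubsets? : ∀ {n} {P : Subset n → Set} → Pred? P → Dec (∀ x → P x)
allSubsets? P? with anySubset? (λ x → ¬? (P? x))
... | yes (x , ¬p) = no (λ all → ¬p (all x))
... | no none      = yes (λ x → decidable-stable (P? x) (λ ¬p → none (x , ¬p)))

shatters? : ∀ {n} {g : Subset n → Set} → Pred? g → Pred? (g shatters_)
shatters? g? S =
  allSubsets? (λ T → (T ⊆? S) →-dec anySubset? (λ F → g? F ×-dec (F ∩ S ≟ T)))

-- g is (s-)extremal when it shatters no more sets than it has members
-- (by Pajor's inequality below this means |Sh(g)| = |g|).
Extremal : ∀ {n} {g : Subset n → Set} → Pred? g → Set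
Extremal g? = count (shatters? g?) ≤ count g?

shatters-without-head : ∀ {n} (g : Subset (suc n) → Set) S →
  (λ x → g (false ∷ x) ⊎ g (true ∷ x)) shatters S → g shatters (false ∷ S)
shatters-without-head g S sh (true ∷ T) T⊆ with T⊆ here
... | ()
shatters-without-head g S sh (false ∷ T) T⊆ with sh T (drop-∷-⊆ T⊆)
... | F , inj₁ gF , F∩S≡T = false ∷ F , gF , cong (false ∷_) F∩S≡T
... | F , inj₂ gF , F∩S≡T = true ∷ F , gF , cong (false ∷_) F∩S≡T

shatters-with-head : ∀ {n} (g : Subset (suc n) → Set) S →
  (λ x → g (false ∷ x) × g (true ∷ x)) shatters S → g shatters (true ∷ S)
shatters-with-head g S sh (b ∷ T) T⊆ with sh T (drop-∷-⊆ T⊆) | b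
... | F , (g₀F , _) , F∩S≡T | false = false ∷ F , g₀F , cong (false ∷_) F∩S≡T
... | F , (_ , g₁F) , F∩S≡T | true  = true ∷ F , g₁F , cong (true ∷_) F∩S≡T

-- Induction on n: |g| = |g₀ ∪ g₁| + |g₀ ∩ g₁|, and the sets
-- shattered by these two families inject into those shattered by g.
pajor : ∀ {n} {g : Subset n → Set} (g? : Pred? g) → count g? ≤ count (shatters? g?)
pajor {zero} g? = count-mono g? (shatters? g?) (λ { [] gF [] _ → [] , gF , refl })
pajor {suc n} {g} g? = begin
  count g₀? + count g₁?                       ≡⟨ count-∪∩ g₀? g₁? ⟩
  count g₀∪g₁? + count g₀∩g₁?                 ≤⟨ +-mono-≤ (pajor g₀∪g₁?) (pajor g₀∩g₁?) ⟩
  count (shatters? g₀∪g₁?) + count (shatters? g₀∩g₁?)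
    ≤⟨ +-mono-≤ (count-mono (shatters? g₀∪g₁?) (λ S → shatters? g? (false ∷ S))
                            (shatters-without-head g))
                (count-mono (shatters? g₀∩g₁?) (λ S → shatters? g? (true ∷ S))
                            (shatters-with-head g)) ⟩
  count (shatters? g?)                        ∎
  where
  open ≤-Reasoning
  g₀? : Pred? (λ x → g (false ∷ x))
  g₀? x = g? (false ∷ x)
  g₁? : Pred? (λ x → g (true ∷ x))
  g₁? x = g? (true ∷ x)
  g₀∪g₁? : Pred? (λ x → g (false ∷ x) ⊎ g (true ∷ x))
  g₀∪g₁? x = g₀? x ⊎-dec g₁? x
  g₀∩g₁? : Pred? (λ x → g (false ∷ x) × g (true ∷ x))
  g₀∩g₁? x = g₀? x ×-dec g₁? x

update-self : ∀ {n} (i : Fin n) {b} (S : Subset n) → lookup S i ≡ b → S [ i ]≔ b ≡ S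
update-self i S refl = []≔-lookup S i

∩-update : ∀ {n} (i : Fin n) a b (F S : Subset n) →
  (F [ i ]≔ a) ∩ (S [ i ]≔ b) ≡ (F ∩ S) [ i ]≔ (a ∧ b)
∩-update zero    a b (_ ∷ F) (_ ∷ S) = refl
∩-update (suc i) a b (x ∷ F) (y ∷ S) = cong ((x ∧ y) ∷_) (∩-update i a b F S)

∩-update-outside : ∀ {n} (i : Fin n) b (F S : Subset n) → lookup S i ≡ false →
  (F [ i ]≔ b) ∩ S ≡ F ∩ S
∩-update-outside zero    b (x ∷ F) (false ∷ S) refl =
  cong (_∷ F ∩ S) (trans (∧-zeroʳ b) (sym (∧-zeroʳ x)))
∩-update-outside (suc i) b (x ∷ F) (y ∷ S) i∉S =
  cong ((x ∧ y) ∷_) (∩-update-outside i b F S i∉S)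

⊆-remove : ∀ {n} (i : Fin n) {T S : Subset n} → T ⊆ S [ i ]≔ true → T [ i ]≔ false ⊆ S
⊆-remove zero    {_ ∷ T}      {_ ∷ S} T⊆S+i = out⊆ (drop-∷-⊆ T⊆S+i)
⊆-remove (suc i) {outside ∷ T} {_ ∷ S} T⊆S+i = out⊆ (⊆-remove i (drop-∷-⊆ T⊆S+i))
⊆-remove (suc i) {inside ∷ T}  {_ ∷ S} T⊆S+i with T⊆S+i here
... | here = in⊆in (⊆-remove i (drop-∷-⊆ T⊆S+i))

∣add∣ : ∀ {n} (i : Fin n) (S : Subset n) → lookup S i ≡ false → ∣ S [ i ]≔ true ∣ ≡ suc ∣ S ∣
∣add∣ zero    (false ∷ S) refl = refl
∣add∣ (suc i) (false ∷ S) i∉S  = ∣add∣ i S i∉S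
∣add∣ (suc i) (true ∷ S)  i∉S  = cong suc (∣add∣ i S i∉S)

∣remove∣ : ∀ {n} (i : Fin n) (S : Subset n) → lookup S i ≡ true →
  ∣ S ∣ ≡ suc ∣ S [ i ]≔ false ∣
∣remove∣ i S i∈S = begin
  ∣ S ∣                           ≡⟨ cong ∣_∣ (sym (update-self i S i∈S)) ⟩
  ∣ S [ i ]≔ true ∣               ≡⟨ cong ∣_∣ (sym ([]≔-idempotent S i)) ⟩
  ∣ (S [ i ]≔ false) [ i ]≔ true ∣ ≡⟨ ∣add∣ i (S [ i ]≔ false) (lookup∘update i S false) ⟩
  suc ∣ S [ i ]≔ false ∣          ∎
  where open ≡-Reasoning

nonempty-member : ∀ {n} (S : Subset n) {m} → ∣ S ∣ ≡ suc m → ∃ λ i → lookup S i ≡ true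
nonempty-member (true ∷ S)  _        = zero , refl
nonempty-member (false ∷ S) ∣S∣≡1+m with nonempty-member S ∣S∣≡1+m
... | i , i∈S = suc i , i∈S

lowerHalf upperHalf : ∀ {n} → Fin n → (Subset n → Set) → Subset n → Set
lowerHalf i g F = lookup F i ≡ false × g F
upperHalf i g F = lookup F i ≡ false × g (F [ i ]≔ true)

lowerHalf? : ∀ {n} (i : Fin n) {g : Subset n → Set} → Pred? g → Pred? (lowerHalf i g)
lowerHalf? i g? F = (lookup F i Bool.≟ false) ×-dec g? F

upperHalf? : ∀ {n} (i : Fin n) {g : Subset n → Set} → Pred? g → Pred? (upperHalf i g)
upperHalf? i g? F = (lookup F i Bool.≟ false) ×-dec g? (F [ i ]≔ true)

-- Every subset either avoids i or is obtained by adding i to one that does.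
count-halves : ∀ {n} (i : Fin n) {g : Subset n → Set} (g? : Pred? g) →
  count g? ≡ count (lowerHalf? i g?) + count (upperHalf? i g?)
count-halves zero g? =
  sym (cong₂ _+_ (head-outside (λ x → g? (false ∷ x)) (λ x → g? (true ∷ x)))
                 (head-outside (λ x → g? (true ∷ x)) (λ x → g? (true ∷ x))))
  where
  -- Along coordinate 0 only the sets with 0 ∉ contribute to either half.
  head-outside : ∀ {n} {P Q : Subset n → Set} (P? : Pred? P) (Q? : Pred? Q) →
    count (λ x → (false Bool.≟ false) ×-dec P? x)
      + count (λ x → (true Bool.≟ false) ×-dec Q? x) ≡ count P?
  head-outside P? Q? =
    trans (cong₂ _+_ (count-cong (λ x → (false Bool.≟ false) ×-dec P? x) P?
                                 (λ _ → proj₂) (λ _ p → refl , p))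
                     (count-empty (λ x → (true Bool.≟ false) ×-dec Q? x) (λ _ ())))
          (+-identityʳ (count P?))
count-halves (suc i) {g} g? = begin
  count g₀? + count g₁?
    ≡⟨ cong₂ _+_ (count-halves i g₀?) (count-halves i g₁?) ⟩
  (count (lowerHalf? i g₀?) + count (upperHalf? i g₀?))
    + (count (lowerHalf? i g₁?) + count (upperHalf? i g₁?))
    ≡⟨ interchange (count (lowerHalf? i g₀?)) (count (upperHalf? i g₀?))
                   (count (lowerHalf? i g₁?)) (count (upperHalf? i g₁?)) ⟩
  (count (lowerHalf? i g₀?) + count (lowerHalf? i g₁?))
    + (count (upperHalf? i g₀?) + count (upperHalf? i g₁?)) ∎
  where
  open ≡-Reasoning
  g₀? : Pred? (λ x → g (false ∷ x))
  g₀? x = g? (false ∷ x)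
  g₁? : Pred? (λ x → g (true ∷ x))
  g₁? x = g? (true ∷ x)

shattered-avoids : ∀ {n} (i : Fin n) {h : Subset n → Set} →
  (∀ F → h F → lookup F i ≡ false) → ∀ S → h shatters S → lookup S i ≡ false
shattered-avoids i avoids S sh with sh S ⊆-refl
... | F , hF , F∩S≡S = begin
  lookup S i               ≡⟨ cong (λ X → lookup X i) (sym F∩S≡S) ⟩
  lookup (F ∩ S) i         ≡⟨ lookup-zipWith _∧_ i F S ⟩
  lookup F i ∧ lookup S i  ≡⟨ cong (_∧ lookup S i) (avoids F hF) ⟩
  false                    ∎
  where open ≡-Reasoning

squeeze : ∀ {a b c d x y : ℕ} → c ≤ a → a ≤ x → d ≤ b → b ≤ y → x + y ≤ c + d → y ≤ b × b ≤ d
squeeze {c = c} {x = x} c≤a a≤x d≤b b≤y x+y≤c+d =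
  +-cancelˡ-≤ _ _ _ (≤-trans x+y≤c+d (+-mono-≤ c≤x d≤b)) ,
  +-cancelˡ-≤ _ _ _ (≤-trans (+-mono-≤ c≤x b≤y) x+y≤c+d)
  where
  c≤x : c ≤ x
  c≤x = ≤-trans c≤a a≤x

-- The decomposition of a family g along a coordinate i into
--   merged(g) = lower ∪ upper  (the traces of g on [n] ∖ {i}), and
--   paired(g) = lower ∩ upper  (sets F ∌ i with both F and F ∪ {i} in g).
module AlongCoordinate {n} (i : Fin n) {g : Subset n → Set} (g? : Pred? g) where

  merged paired : Subset n → Set
  merged F = lowerHalf i g F ⊎ upperHalf i g F
  paired F = lowerHalf i g F × upperHalf i g F

  merged? : Pred? merged
  merged? F = lowerHalf? i g? F ⊎-dec upperHalf? i g? F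

  paired? : Pred? paired
  paired? F = lowerHalf? i g? F ×-dec upperHalf? i g? F

  count-merged+paired : count g? ≡ count merged? + count paired?
  count-merged+paired = trans (count-halves i g?) (count-∪∩ (lowerHalf? i g?) (upperHalf? i g?))

  merged-shatters : ∀ S → merged shatters S → lowerHalf i (g shatters_) S
  merged-shatters S sh = i∉S , trace
    where
    i∉S : lookup S i ≡ false
    i∉S = shattered-avoids i (λ { F (inj₁ (i∉F , _)) → i∉F ; F (inj₂ (i∉F , _)) → i∉F }) S sh
    trace : ∀ T → T ⊆ S → ∃ λ F → g F × F ∩ S ≡ T
    trace T T⊆S with sh T T⊆S
    ... | F , inj₁ (_ , gF) , F∩S≡T = F , gF , F∩S≡T
    ... | F , inj₂ (_ , gF⁺) , F∩S≡T =
      F [ i ]≔ true , gF⁺ , trans (∩-update-outside i true F S i∉S) F∩S≡T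

  paired-shatters : ∀ S → paired shatters S → upperHalf i (g shatters_) S
  paired-shatters S sh = i∉S , trace
    where
    i∉S : lookup S i ≡ false
    i∉S = shattered-avoids i (λ F → λ ((i∉F , _) , _) → i∉F) S sh
    trace : ∀ T → T ⊆ S [ i ]≔ true → ∃ λ F → g F × F ∩ (S [ i ]≔ true) ≡ T
    trace T T⊆S+i with sh (T [ i ]≔ false) (⊆-remove i T⊆S+i)
    ... | F , ((i∉F , gF) , (_ , gF⁺)) , F∩S≡T-i =
      F [ i ]≔ lookup T i , member (lookup T i) , (begin
        (F [ i ]≔ lookup T i) ∩ (S [ i ]≔ true)
          ≡⟨ ∩-update i (lookup T i) true F S ⟩
        (F ∩ S) [ i ]≔ (lookup T i ∧ true)
          ≡⟨ cong₂ (λ X b → X [ i ]≔ b) F∩S≡T-i (∧-identityʳ (lookup T i)) ⟩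
        (T [ i ]≔ false) [ i ]≔ lookup T i
          ≡⟨ []≔-idempotent T i ⟩
        T [ i ]≔ lookup T i
          ≡⟨ []≔-lookup T i ⟩
        T ∎)
      where
      open ≡-Reasoning
      member : ∀ b → g (F [ i ]≔ b)
      member true  = gF⁺
      member false = subst g (sym (update-self i F i∉F)) gF

  -- For extremal g, Pajor's inequality for merged(g) and paired(g) must be
  -- tight: paired(g) is extremal and shatters S ∖ {i} whenever g shatters S ∋ i.
  module _ (extremal : Extremal g?) where

    private
      tight : count (upperHalf? i (shatters? g?)) ≤ count (shatters? paired?)
            × count (shatters? paired?) ≤ count paired?
      tight =
        squeeze (pajor merged?)
                (count-mono (shatters? merged?) (lowerHalf? i (shatters? g?)) merged-shatters)
                (pajor paired?)
                (count-mono (shatters? paired?) (upperHalf? i (shatters? g?)) paired-shatters)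
                (subst₂ _≤_ (count-halves i (shatters? g?)) count-merged+paired extremal)

    paired-extremal : Extremal paired?
    paired-extremal = proj₂ tight

    paired-shatters-removal : ∀ S → lookup S i ≡ true → g shatters S →
      paired shatters (S [ i ]≔ false)
    paired-shatters-removal S i∈S sh =
      count-reflect (shatters? paired?) (upperHalf? i (shatters? g?)) paired-shatters (proj₁ tight)
        (S [ i ]≔ false) (lookup∘update i S false , subst (g shatters_) S≡S-i+i sh)
      where
      S≡S-i+i : S ≡ (S [ i ]≔ false) [ i ]≔ true
      S≡S-i+i = trans (sym (update-self i S i∈S)) (sym ([]≔-idempotent S i))

-- An extremal family that shatters a set S of size m contains two members
-- whose sizes differ by m (in fact A and A ∪ S): remove a point i of S,
-- pass to paired(g), and add i back to the larger member.
size-gap : ∀ m {n} {g : Subset n → Set} (g? : Pred? g) → Extremal g? →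
  ∀ S → ∣ S ∣ ≡ m → g shatters S → ∃₂ λ A B → g A × g B × ∣ B ∣ ≡ ∣ A ∣ + m
size-gap zero g? _ S _ sh with sh S ⊆-refl
... | F , gF , _ = F , F , gF , gF , sym (+-identityʳ ∣ F ∣)
size-gap (suc m) g? extremal S ∣S∣≡1+m sh with nonempty-member S ∣S∣≡1+m
... | i , i∈S with size-gap m paired? (paired-extremal extremal) (S [ i ]≔ false)
                     (suc-injective (trans (sym (∣remove∣ i S i∈S)) ∣S∣≡1+m))
                     (paired-shatters-removal extremal S i∈S sh)
  where open AlongCoordinate i g?
... | A , B , ((_ , gA) , _) , (_ , (i∉B , gB⁺)) , ∣B∣≡∣A∣+m =
  A , B [ i ]≔ true , gA , gB⁺ ,
  trans (∣add∣ i B i∉B) (trans (cong suc ∣B∣≡∣A∣+m) (sym (+-suc ∣ A ∣ m)))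

level-gap : ∀ {k d a b s} → d ≤ k → k ∸ d ≤ a → b ≤ k → b ≡ a + s → s ≤ d
level-gap {k} {d} {a} {b} {s} d≤k k-d≤a b≤k b≡a+s = begin
  s          ≡⟨ sym (m+n∸m≡n a s) ⟩
  a + s ∸ a  ≡⟨ cong (_∸ a) (sym b≡a+s) ⟩
  b ∸ a      ≤⟨ ∸-mono b≤k k-d≤a ⟩
  k ∸ (k ∸ d) ≡⟨ m∸[m∸n]≡n d≤k ⟩
  d          ∎
  where open ≤-Reasoning

family-extremal : ∀ {n} (𝓕 : Family n) → SExtremal 𝓕 → Extremal (_∈? members 𝓕)
family-extremal 𝓕 (L , isSh , ∣L∣≡∣𝓕∣) = ≤-reflexive (begin
  count (shatters? (_∈? members 𝓕))
    ≡⟨ count-cong (shatters? (_∈? members 𝓕)) (_∈? members L)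
                  (λ S → Equivalence.from (isSh S)) (λ S → Equivalence.to (isSh S)) ⟩
  count (_∈? members L)   ≡⟨ count-∈ (members L) (distinct L) ⟩
  card L                  ≡⟨ ∣L∣≡∣𝓕∣ ⟩
  card 𝓕                  ≡⟨ count-∈ (members 𝓕) (distinct 𝓕) ⟨
  count (_∈? members 𝓕)   ∎)
  where open ≡-Reasoning

mainTheorem5 : (n k t : ℕ) → k ≤ n → t ∸ 1 ≤ k → 1 ≤ t ∸ 1 →
    (𝓕 : Family n) → InLevels 𝓕 k t → SExtremal 𝓕 → VCdimAtMost 𝓕 (t ∸ 1)
mainTheorem5 n k t _ t-1≤k _ 𝓕 levels sExtremal S shattered =
  let A , B , A∈𝓕 , B∈𝓕 , ∣B∣≡∣A∣+∣S∣ =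
        size-gap ∣ S ∣ (_∈? members 𝓕) (family-extremal 𝓕 sExtremal) S refl shattered
  in level-gap t-1≤k (proj₁ (levels A A∈𝓕)) (proj₂ (levels B B∈𝓕)) ∣B∣≡∣A∣+∣S∣
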